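{- Let $U\subseteq\mathbb{R}^d$ be finite and let $(U,\mathcal{F})$ be its affine convex geometry. Then for any essential set $C$ of $(U,\mathcal{F})$, the unique inclusion-wise maximal quasi-closed set of $C$ is $\mathrm{ex}(C)$.
   Context: The affine convex geometry of a finite $U\subseteq\mathbb{R}^d$ is the closure system whose closure operator is $\phi(Y)=\mathrm{conv}(Y)\cap U$ (conv the convex hull), with closed sets $\mathcal{F}=\{C\subseteq U:\phi(C)=C\}$. $\mathrm{ex}(A)=\{x\in A: x\notin\phi(A\setminus\{x\})\}$. A set $Q$ is quasi-closed if $Q$ is not closed and for every $A\subseteq Q$, $\phi(A)\subsetneq\phi(Q)$ implies $\phi(A)\subseteq Q$. A closed set $C$ is essential if $C=\phi(Q)$ for some quasi-closed $Q$; the quasi-closed sets of $C$ are the quasi-closed $Q$ with $\phi(Q)=C$. -}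

module Defs where

open import Level using (0ℓ)
open import Data.Nat using (ℕ; zero; suc)
open import Data.Fin using (Fin; zero; suc)
open import Data.Fin.Subset using (Subset; _∈_; _∉_; _⊆_; _-_)
open import Data.Product using (Σ; ∃; _×_; _,_)
open import Relation.Nullary using (¬_)
open import Relation.Binary.PropositionalEquality using (_≡_)
open import Relation.Binary using (IsTotalOrder)
open import Algebra.Bundles using (CommutativeRing)

-- An ordered field: a commutative ring with 0 ≠ 1 in which every nonzero
-- element is invertible, equipped with a total order compatible with + and *.
-- (ℝ is an instance; the stdlib has no reals.)
record OrderedField : Set₁ where
  field
    commutativeRing : CommutativeRing 0ℓ 0ℓ
  open CommutativeRing commutativeRing public
  infix 4 _≤_
  field
    _≤_          : Carrier → Carrier → Set
    isTotalOrder : IsTotalOrder _≈_ _≤_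
    0≉1          : ¬ (0# ≈ 1#)
    inverse      : ∀ x → ¬ (x ≈ 0#) → ∃ λ y → x * y ≈ 1#
    +-mono-≤     : ∀ {x y} z → x ≤ y → x + z ≤ y + z
    *-nonneg     : ∀ {x y} → 0# ≤ x → 0# ≤ y → 0# ≤ x * y

module ConvexGeometry (K : OrderedField) where
  open OrderedField K using (Carrier; _≈_; _≤_; _+_; _*_; 0#; 1#)

  Point : ℕ → Set
  Point d = Fin d → Carrier

  _≈ₚ_ : ∀ {d} → Point d → Point d → Set
  x ≈ₚ y = ∀ k → x k ≈ y k

  sum : ∀ {n} → (Fin n → Carrier) → Carrier
  sum {zero}  f = 0#
  sum {suc n} f = f zero + sum (λ i → f (suc i))

  -- A finite point set U ⊆ K^d with n elements: an injective enumeration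
  -- p : Fin n → K^d.  Subsets of U are represented as Subset n.
  record FinitePointSet (d : ℕ) : Set where
    field
      n      : ℕ
      pt     : Fin n → Point d
      pt-inj : ∀ i j → pt i ≈ₚ pt j → i ≡ j

  module _ {d : ℕ} (U : FinitePointSet d) where
    open FinitePointSet U

    InConv : Subset n → Point d → Set
    InConv Y x =
      Σ (Fin n → Carrier) λ c →
        (∀ j → 0# ≤ c j) ×
        (∀ j → j ∉ Y → c j ≈ 0#) ×
        (sum c ≈ 1#) ×
        (∀ k → sum (λ j → c j * pt j k) ≈ x k)

    -- i ∈ φ(Y) = conv(Y) ∩ U
    _∈φ_ : Fin n → Subset n → Set
    i ∈φ Y = InConv Y (pt i)

    _⊆φ_ : Subset n → Subset n → Set
    A ⊆φ B = ∀ i → i ∈φ A → i ∈φ B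

    _⊊φ_ : Subset n → Subset n → Set
    A ⊊φ B = (A ⊆φ B) × ¬ (B ⊆φ A)

    φ_⊆_ : Subset n → Subset n → Set
    φ A ⊆ B = ∀ i → i ∈φ A → i ∈ B

    φ_≐_ : Subset n → Subset n → Set
    φ Q ≐ C = ∀ i → (i ∈φ Q → i ∈ C) × (i ∈ C → i ∈φ Q)

    Closed : Subset n → Set
    Closed C = φ C ⊆ C   -- C ⊆ φ(C) always holds

    QuasiClosed : Subset n → Set
    QuasiClosed Q =
      ¬ Closed Q ×
      (∀ A → A ⊆ Q → A ⊊φ Q → φ A ⊆ Q)

    QuasiClosedOf : Subset n → Subset n → Set
    QuasiClosedOf C Q = QuasiClosed Q × (φ Q ≐ C)

    Essential : Subset n → Set
    Essential C = Σ (Subset n) λ Q → QuasiClosedOf C Q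

    IsEx : Subset n → Subset n → Set
    IsEx A E = ∀ i → (i ∈ E → i ∈ A × ¬ (i ∈φ (A - i)))
                   × (i ∈ A × ¬ (i ∈φ (A - i)) → i ∈ E)

-- A point of ex(C) cannot be missing from a set Q with φ(Q) = C: otherwise Q ⊆ C ∖ x and
-- x ∈ C ⊆ φ(C ∖ x).  Conversely, a quasi-closed Q is convexly independent.  Pick an
-- independent B ⊆ Q with Q ⊆ φ(B) and a point y ∈ φ(Q) ∖ Q.  If some x ∈ Q lay outside B, the
-- ratio test of the simplex method would trade x for a point b ∈ B, putting y into φ(Q ∖ b);
-- as b is extreme, φ(Q ∖ b) ⊊ φ(Q), so quasi-closedness forces y ∈ Q.  Hence Q = B, and the
-- points of an independent Q with C ⊆ φ(Q) remain extreme in C, i.e. Q ⊆ ex(C).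
-- Classical reasoning is confined to double negations, which suffices since every
-- undecidable step ends in a contradiction.

module Submission where

open import Defs
open import Level using (0ℓ)
open import Data.Nat using (ℕ; zero; suc)
open import Data.Fin using (Fin; zero; suc; _≟_)
open import Data.Fin.Properties using (∀-cons; ¬∀⟶∃¬)
open import Data.Fin.Subset using (Subset; _∈_; _∉_; _⊆_; _⊂_; _─_; _∪_; ⁅_⁆; inside)
  renaming (_-_ to _∖_)
open import Data.Fin.Subset.Properties
  using (_∈?_; ⊆-antisym; p─q⊆p; x∈⁅x⁆; x∈⁅y⁆⇒x≡y; x∈p∧x≢y⇒x∈p-y; x∈p⇒p-x⊂p; x∈p∪q⁻; x∈p∪q⁺)
open import Data.Fin.Subset.Induction using (⊂-wellFounded)
open import Data.List using (List; filter; allFin)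
open import Data.List.Membership.Propositional.Properties using (∈-filter⁺; ∈-allFin)
open import Data.List.Relation.Unary.All using (lookup)
open import Data.List.Relation.Unary.All.Properties using (all-filter)
open import Data.Product using (∃; _×_; _,_; proj₁; proj₂)
open import Data.Sum using (inj₁; inj₂)
open import Data.Vec using (_∷_; here; there)
open import Data.Empty using (⊥-elim)
open import Function using (_∘_)
open import Induction.WellFounded using (Acc; acc)
open import Relation.Binary using (TotalOrder; Poset; IsTotalOrder)
open import Relation.Binary.PropositionalEquality as ≡ using (_≡_; _≢_; subst)
open import Relation.Nullary using (¬_; Dec; yes; no; ¬?)
open import Relation.Nullary.Negation using (¬¬-map)
open import Relation.Nullary.Decidable using (¬¬-excluded-middle)
open import Relation.Unary using (Pred; Decidable)
import Relation.Binary.Reasoning.PartialOrder as PartialOrderReasoning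
import Relation.Binary.Reasoning.Setoid as SetoidReasoning

x∈p─q⇒x∉q : ∀ {n} {x : Fin n} (p q : Subset n) → x ∈ p ─ q → x ∉ q
x∈p─q⇒x∉q (s ∷ p) (inside ∷ q)  ()          here
x∈p─q⇒x∉q (s ∷ p) (t ∷ q)       (there x∈) (there x∈q) = x∈p─q⇒x∉q p q x∈ x∈q

x∉p∖x : ∀ {n} {x : Fin n} (p : Subset n) → x ∉ p ∖ x
x∉p∖x {x = x} p x∈ = x∈p─q⇒x∉q p ⁅ x ⁆ x∈ (x∈⁅x⁆ x)

x∈p∖y⇒x≢y : ∀ {n} {x y : Fin n} (p : Subset n) → x ∈ p ∖ y → x ≢ y
x∈p∖y⇒x≢y p x∈ ≡.refl = x∉p∖x p x∈

¬¬-∀ : ∀ {m p} {P : Pred (Fin m) p} → (∀ i → ¬ ¬ P i) → ¬ ¬ (∀ i → P i)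
¬¬-∀ {zero}  _ k = k (λ ())
¬¬-∀ {suc m} h k = h zero λ p₀ → ¬¬-∀ (h ∘ suc) λ ps → k (∀-cons p₀ ps)

module _ (K : OrderedField) where
  open OrderedField K hiding (zero)
  open IsTotalOrder isTotalOrder using (total; antisym; isPartialOrder)
    renaming (reflexive to ≤-reflexive; trans to ≤-trans)
  open import Algebra.Properties.Ring ring using (-1*x≈-x; -‿distribˡ-*; -‿distribʳ-*; x[y-z]≈xy-xz)
  open import Algebra.Properties.Group +-group using (x∙y⁻¹≈ε⇒x≈y; ⁻¹-involutive; //-rightDividesˡ; //-rightDividesʳ)
  open import Algebra.Properties.Semiring.Sum semiring
    using (∑-comm; ∑-distrib-+; *-distribˡ-sum; *-distribʳ-sum; sum-cong-≋; sum-replicate-zero)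
    renaming (sum to ∑)

  poset : Poset 0ℓ 0ℓ 0ℓ
  poset = record { isPartialOrder = isPartialOrder }

  totalOrder : TotalOrder 0ℓ 0ℓ 0ℓ
  totalOrder = record { isTotalOrder = isTotalOrder }

  open ConvexGeometry K
    using (Point; _≈ₚ_; sum; FinitePointSet; InConv; Closed; QuasiClosed; QuasiClosedOf; IsEx; _⊊φ_; φ_≐_)
  open import Data.List.Extrema totalOrder using (argmin; argmin-all; f[argmin]≤f[xs])

  module ≤-Reasoning = PartialOrderReasoning poset
  module ≈-Reasoning = SetoidReasoning setoid

  -- Ordered fields

  x-y≈0⇒x≈y : ∀ {x y} → x - y ≈ 0# → x ≈ y
  x-y≈0⇒x≈y = x∙y⁻¹≈ε⇒x≈y _ _

  x≤y⇒0≤y-x : ∀ {x y} → x ≤ y → 0# ≤ y - x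
  x≤y⇒0≤y-x {x} {y} x≤y = begin
    0#     ≈⟨ -‿inverseʳ x ⟨
    x - x  ≤⟨ +-mono-≤ (- x) x≤y ⟩
    y - x  ∎
    where open ≤-Reasoning

  0≤y-x⇒x≤y : ∀ {x y} → 0# ≤ y - x → x ≤ y
  0≤y-x⇒x≤y {x} {y} 0≤y-x = begin
    x            ≈⟨ +-identityˡ x ⟨
    0# + x       ≤⟨ +-mono-≤ x 0≤y-x ⟩
    (y - x) + x  ≈⟨ //-rightDividesˡ x y ⟩
    y            ∎
    where open ≤-Reasoning

  x≤0⇒0≤-x : ∀ {x} → x ≤ 0# → 0# ≤ - x
  x≤0⇒0≤-x {x} x≤0 = begin
    0#      ≤⟨ x≤y⇒0≤y-x x≤0 ⟩
    0# - x  ≈⟨ +-identityˡ (- x) ⟩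
    - x     ∎
    where open ≤-Reasoning

  0≤-x⇒x≤0 : ∀ {x} → 0# ≤ - x → x ≤ 0#
  0≤-x⇒x≤0 {x} 0≤-x = 0≤y-x⇒x≤y (begin
    0#      ≤⟨ 0≤-x ⟩
    - x     ≈⟨ +-identityˡ (- x) ⟨
    0# - x  ∎)
    where open ≤-Reasoning

  +-monoʳ-≤ : ∀ {x y} z → x ≤ y → z + x ≤ z + y
  +-monoʳ-≤ {x} {y} z x≤y = begin
    z + x  ≈⟨ +-comm z x ⟩
    x + z  ≤⟨ +-mono-≤ z x≤y ⟩
    y + z  ≈⟨ +-comm y z ⟩
    z + y  ∎
    where open ≤-Reasoning

  +-mono₂-≤ : ∀ {x y u v} → x ≤ y → u ≤ v → x + u ≤ y + v
  +-mono₂-≤ {y = y} {u} x≤y u≤v = ≤-trans (+-mono-≤ u x≤y) (+-monoʳ-≤ y u≤v)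

  +-nonneg : ∀ {x y} → 0# ≤ x → 0# ≤ y → 0# ≤ x + y
  +-nonneg 0≤x 0≤y = ≤-trans (≤-reflexive (sym (+-identityʳ 0#))) (+-mono₂-≤ 0≤x 0≤y)

  +-cancelʳ-≤ : ∀ {x y} z → x + z ≤ y + z → x ≤ y
  +-cancelʳ-≤ {x} {y} z x+z≤y+z = begin
    x            ≈⟨ //-rightDividesʳ z x ⟨
    (x + z) - z  ≤⟨ +-mono-≤ (- z) x+z≤y+z ⟩
    (y + z) - z  ≈⟨ //-rightDividesʳ z y ⟩
    y            ∎
    where open ≤-Reasoning

  +-cancelˡ-≤ : ∀ {x y} z → z + x ≤ z + y → x ≤ y
  +-cancelˡ-≤ {x} {y} z z+x≤z+y = +-cancelʳ-≤ z (begin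
    x + z  ≈⟨ +-comm x z ⟩
    z + x  ≤⟨ z+x≤z+y ⟩
    z + y  ≈⟨ +-comm z y ⟩
    y + z  ∎)
    where open ≤-Reasoning

  0≤1 : 0# ≤ 1#
  0≤1 with total 0# 1#
  ... | inj₁ 0≤1 = 0≤1
  ... | inj₂ 1≤0 = begin
    0#            ≤⟨ *-nonneg 0≤-1 0≤-1 ⟩
    - 1# * - 1#   ≈⟨ -1*x≈-x (- 1#) ⟩
    - - 1#        ≈⟨ ⁻¹-involutive 1# ⟩
    1#            ∎
    where
    open ≤-Reasoning
    0≤-1 : 0# ≤ - 1#
    0≤-1 = x≤0⇒0≤-x 1≤0

  *-monoʳ-≤ : ∀ {x y} z → 0# ≤ z → x ≤ y → x * z ≤ y * z
  *-monoʳ-≤ {x} {y} z 0≤z x≤y = 0≤y-x⇒x≤y (begin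
    0#                ≤⟨ *-nonneg (x≤y⇒0≤y-x x≤y) 0≤z ⟩
    (y - x) * z       ≈⟨ distribʳ z y (- x) ⟩
    y * z + - x * z   ≈⟨ +-congˡ (-‿distribˡ-* x z) ⟨
    y * z - x * z     ∎)
    where open ≤-Reasoning

  *-monoˡ-≤ : ∀ {x y} z → 0# ≤ z → x ≤ y → z * x ≤ z * y
  *-monoˡ-≤ {x} {y} z 0≤z x≤y = begin
    z * x  ≈⟨ *-comm z x ⟩
    x * z  ≤⟨ *-monoʳ-≤ z 0≤z x≤y ⟩
    y * z  ≈⟨ *-comm y z ⟩
    z * y  ∎
    where open ≤-Reasoning

  inverse-nonneg : ∀ {x y} → 0# ≤ x → x * y ≈ 1# → 0# ≤ y
  inverse-nonneg {x} {y} 0≤x xy≈1 with total 0# y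
  ... | inj₁ 0≤y = 0≤y
  ... | inj₂ y≤0 = ⊥-elim (0≉1 (antisym 0≤1 (0≤-x⇒x≤0 (begin
    0#         ≤⟨ *-nonneg 0≤x (x≤0⇒0≤-x y≤0) ⟩
    x * - y    ≈⟨ -‿distribʳ-* x y ⟨
    - (x * y)  ≈⟨ -‿cong xy≈1 ⟩
    - 1#       ∎))))
    where open ≤-Reasoning

  +-tight : ∀ {x y u v} → x ≤ y → u ≤ v → x + u ≈ y + v → x ≈ y × u ≈ v
  +-tight {x} {y} {u} {v} x≤y u≤v x+u≈y+v = antisym x≤y y≤x , antisym u≤v v≤u
    where
    open ≤-Reasoning
    y≤x : y ≤ x
    y≤x = +-cancelʳ-≤ u (begin
      y + u  ≤⟨ +-monoʳ-≤ y u≤v ⟩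
      y + v  ≈⟨ x+u≈y+v ⟨
      x + u  ∎)
    v≤u : v ≤ u
    v≤u = +-cancelˡ-≤ x (begin
      x + v  ≤⟨ +-mono-≤ v x≤y ⟩
      y + v  ≈⟨ x+u≈y+v ⟨
      x + u  ∎)

  x*y≈x⇒x≈0 : ∀ {x y} → ¬ y ≈ 1# → x * y ≈ x → x ≈ 0#
  x*y≈x⇒x≈0 {x} {y} y≉1 xy≈x = begin
    x                   ≈⟨ *-identityʳ x ⟨
    x * 1#              ≈⟨ *-congˡ (proj₂ y-1⁻¹) ⟨
    x * ((y - 1#) * r)  ≈⟨ *-assoc x (y - 1#) r ⟨
    x * (y - 1#) * r    ≈⟨ *-congʳ (x[y-z]≈xy-xz x y 1#) ⟩
    (x * y - x * 1#) * r ≈⟨ *-congʳ (+-cong xy≈x (-‿cong (*-identityʳ x))) ⟩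
    (x - x) * r         ≈⟨ *-congʳ (-‿inverseʳ x) ⟩
    0# * r              ≈⟨ zeroˡ r ⟩
    0#                  ∎
    where
    open ≈-Reasoning
    y-1⁻¹ : ∃ λ r → (y - 1#) * r ≈ 1#
    y-1⁻¹ = inverse (y - 1#) (y≉1 ∘ x-y≈0⇒x≈y)
    r : Carrier
    r = proj₁ y-1⁻¹

  x+-a*y+a*y≈x : ∀ x a y → (x + - a * y) + a * y ≈ x
  x+-a*y+a*y≈x x a y = begin
    (x + - a * y) + a * y    ≈⟨ +-assoc x (- a * y) (a * y) ⟩
    x + (- a * y + a * y)    ≈⟨ +-congˡ (distribʳ y (- a) a) ⟨
    x + (- a + a) * y        ≈⟨ +-congˡ (*-congʳ (-‿inverseˡ a)) ⟩
    x + 0# * y               ≈⟨ +-congˡ (zeroˡ y) ⟩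
    x + 0#                   ≈⟨ +-identityʳ x ⟩
    x                        ∎
    where open ≈-Reasoning

  r[x+-a*x]≈x : ∀ {a r} x → (1# - a) * r ≈ 1# → r * (x + - a * x) ≈ x
  r[x+-a*x]≈x {a} {r} x [1-a]r≈1 = begin
    r * (x + - a * x)        ≈⟨ *-congˡ (+-congʳ (*-identityˡ x)) ⟨
    r * (1# * x + - a * x)   ≈⟨ *-congˡ (distribʳ x 1# (- a)) ⟨
    r * ((1# - a) * x)       ≈⟨ *-assoc r (1# - a) x ⟨
    r * (1# - a) * x         ≈⟨ *-congʳ (trans (*-comm r (1# - a)) [1-a]r≈1) ⟩
    1# * x                   ≈⟨ *-identityˡ x ⟩
    x                        ∎
    where open ≈-Reasoning

  -- The junk value 0 at 0 is never used: callers only read it off where x ≉ 0.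
  reciprocal : ∀ {x} → Dec (x ≈ 0#) → Carrier
  reciprocal (yes _)        = 0#
  reciprocal {x} (no x≉0)  = proj₁ (inverse x x≉0)

  reciprocal-inverse : ∀ {x} (x? : Dec (x ≈ 0#)) → ¬ x ≈ 0# → x * reciprocal x? ≈ 1#
  reciprocal-inverse (yes x≈0) x≉0 = ⊥-elim (x≉0 x≈0)
  reciprocal-inverse (no x≉0)  _   = proj₂ (inverse _ x≉0)

  reciprocal-nonneg : ∀ {x} (x? : Dec (x ≈ 0#)) → 0# ≤ x → 0# ≤ reciprocal x?
  reciprocal-nonneg (yes _)   _   = ≤-reflexive refl
  reciprocal-nonneg (no x≉0) 0≤x = inverse-nonneg 0≤x (proj₂ (inverse _ x≉0))

  -- Finite sums

  ∑-cong : ∀ {m} {f g : Fin m → Carrier} → (∀ i → f i ≈ g i) → ∑ f ≈ ∑ g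
  ∑-cong = sum-cong-≋

  ∑-zero : ∀ {m} {f : Fin m → Carrier} → (∀ i → f i ≈ 0#) → ∑ f ≈ 0#
  ∑-zero {m} f≈0 = trans (∑-cong f≈0) (sum-replicate-zero m)

  ∑-mono-≤ : ∀ {m} {f g : Fin m → Carrier} → (∀ i → f i ≤ g i) → ∑ f ≤ ∑ g
  ∑-mono-≤ {zero}  f≤g = ≤-reflexive refl
  ∑-mono-≤ {suc m} f≤g = +-mono₂-≤ (f≤g zero) (∑-mono-≤ (f≤g ∘ suc))

  ∑-nonneg : ∀ {m} {f : Fin m → Carrier} → (∀ i → 0# ≤ f i) → 0# ≤ ∑ f
  ∑-nonneg {m} {f} 0≤f = begin
    0#             ≈⟨ sum-replicate-zero m ⟨
    ∑ {m} (λ _ → 0#)  ≤⟨ ∑-mono-≤ 0≤f ⟩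
    ∑ f            ∎
    where open ≤-Reasoning

  x≤∑ : ∀ {m} {f : Fin m → Carrier} → (∀ i → 0# ≤ f i) → ∀ i → f i ≤ ∑ f
  x≤∑ {suc m} {f} 0≤f zero = begin
    f zero                    ≈⟨ +-identityʳ (f zero) ⟨
    f zero + 0#               ≤⟨ +-monoʳ-≤ (f zero) (∑-nonneg (0≤f ∘ suc)) ⟩
    f zero + ∑ (f ∘ suc)      ∎
    where open ≤-Reasoning
  x≤∑ {suc m} {f} 0≤f (suc i) = begin
    f (suc i)                 ≤⟨ x≤∑ (0≤f ∘ suc) i ⟩
    ∑ (f ∘ suc)               ≈⟨ +-identityˡ _ ⟨
    0# + ∑ (f ∘ suc)          ≤⟨ +-mono-≤ (∑ (f ∘ suc)) (0≤f zero) ⟩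
    f zero + ∑ (f ∘ suc)      ∎
    where open ≤-Reasoning

  ∑-tight : ∀ {m} {f g : Fin m → Carrier} → (∀ i → f i ≤ g i) → ∑ f ≈ ∑ g → ∀ i → f i ≈ g i
  ∑-tight {suc m} f≤g ∑f≈∑g zero    = proj₁ (+-tight (f≤g zero) (∑-mono-≤ (f≤g ∘ suc)) ∑f≈∑g)
  ∑-tight {suc m} f≤g ∑f≈∑g (suc i) =
    ∑-tight (f≤g ∘ suc) (proj₂ (+-tight (f≤g zero) (∑-mono-≤ (f≤g ∘ suc)) ∑f≈∑g)) i

  ∃-nonzero : ∀ {m} {c : Fin m → Carrier} → (∀ j → Dec (c j ≈ 0#)) → ∑ c ≈ 1# → ∃ λ j → ¬ c j ≈ 0#
  ∃-nonzero {m} {c} c? ∑c≈1 = ¬∀⟶∃¬ m (λ j → c j ≈ 0#) c? λ c≈0 → 0≉1 (trans (sym (∑-zero c≈0)) ∑c≈1)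

  infix 7 _·_
  _·_ : ∀ {m} → (Fin m → Carrier) → (Fin m → Carrier) → Carrier
  c · v = ∑ λ j → c j * v j

  ·-congˡ : ∀ {m} {c c′ : Fin m → Carrier} (v : Fin m → Carrier) → (∀ j → c j ≈ c′ j) → c · v ≈ c′ · v
  ·-congˡ v c≈c′ = ∑-cong λ j → *-congʳ (c≈c′ j)

  ·-congʳ : ∀ {m} (c : Fin m → Carrier) {v v′ : Fin m → Carrier} → (∀ j → v j ≈ v′ j) → c · v ≈ c · v′
  ·-congʳ c v≈v′ = ∑-cong λ j → *-congˡ (v≈v′ j)

  ·-+* : ∀ {m} (f : Fin m → Carrier) s (g v : Fin m → Carrier) →
         (λ j → f j + s * g j) · v ≈ f · v + s * (g · v)
  ·-+* f s g v = begin
    (λ j → f j + s * g j) · v               ≈⟨ ∑-cong (λ j → distribʳ (v j) (f j) (s * g j)) ⟩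
    ∑ (λ j → f j * v j + s * g j * v j)     ≈⟨ ∑-distrib-+ (λ j → f j * v j) (λ j → s * g j * v j) ⟩
    f · v + ∑ (λ j → s * g j * v j)         ≈⟨ +-congˡ (∑-cong (λ j → *-assoc s (g j) (v j))) ⟩
    f · v + ∑ (λ j → s * (g j * v j))       ≈⟨ +-congˡ (*-distribˡ-sum s (λ j → g j * v j)) ⟨
    f · v + s * (g · v)                     ∎
    where open ≈-Reasoning

  ·-*ˡ : ∀ {m} s (g v : Fin m → Carrier) → (λ j → s * g j) · v ≈ s * (g · v)
  ·-*ˡ s g v = trans (∑-cong λ j → *-assoc s (g j) (v j)) (sym (*-distribˡ-sum s (λ j → g j * v j)))

  δ : ∀ {m} → Fin m → Fin m → Carrier
  δ zero    zero    = 1#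
  δ zero    (suc j) = 0#
  δ (suc i) zero    = 0#
  δ (suc i) (suc j) = δ i j

  δ-diag : ∀ {m} (i : Fin m) → δ i i ≡ 1#
  δ-diag zero    = ≡.refl
  δ-diag (suc i) = δ-diag i

  δ-off : ∀ {m} {i j : Fin m} → i ≢ j → δ i j ≡ 0#
  δ-off {i = zero}  {zero}  i≢j = ⊥-elim (i≢j ≡.refl)
  δ-off {i = zero}  {suc j} i≢j = ≡.refl
  δ-off {i = suc i} {zero}  i≢j = ≡.refl
  δ-off {i = suc i} {suc j} i≢j = δ-off (i≢j ∘ ≡.cong suc)

  δ-nonneg : ∀ {m} (i j : Fin m) → 0# ≤ δ i j
  δ-nonneg i j with i ≟ j
  ... | yes ≡.refl = ≤-trans 0≤1 (≤-reflexive (reflexive (≡.sym (δ-diag i))))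
  ... | no i≢j     = ≤-reflexive (reflexive (≡.sym (δ-off i≢j)))

  δ-· : ∀ {m} (i : Fin m) (v : Fin m → Carrier) → δ i · v ≈ v i
  δ-· zero v = begin
    1# * v zero + ∑ (λ j → 0# * v (suc j))  ≈⟨ +-cong (*-identityˡ (v zero)) (∑-zero (λ j → zeroˡ (v (suc j)))) ⟩
    v zero + 0#                             ≈⟨ +-identityʳ (v zero) ⟩
    v zero                                  ∎
    where open ≈-Reasoning
  δ-· (suc i) v = begin
    0# * v zero + δ i · (v ∘ suc)  ≈⟨ +-cong (zeroˡ (v zero)) (δ-· i (v ∘ suc)) ⟩
    0# + v (suc i)                 ≈⟨ +-identityˡ (v (suc i)) ⟩
    v (suc i)                      ∎
    where open ≈-Reasoning

  ∑-δ : ∀ {m} (i : Fin m) → ∑ (δ i) ≈ 1#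
  ∑-δ i = trans (∑-cong λ j → sym (*-identityʳ (δ i j))) (δ-· i (λ _ → 1#))

  infixl 7 _⊙_
  _⊙_ : ∀ {m} → (Fin m → Carrier) → (Fin m → Fin m → Carrier) → Fin m → Carrier
  (ν ⊙ κ) t = ∑ λ s → ν s * κ s t

  ·-⊙ : ∀ {m} (ν : Fin m → Carrier) (κ : Fin m → Fin m → Carrier) (v : Fin m → Carrier) →
        (ν ⊙ κ) · v ≈ ν · (λ s → κ s · v)
  ·-⊙ ν κ v = begin
    ∑ (λ t → ∑ (λ s → ν s * κ s t) * v t)      ≈⟨ ∑-cong (λ t → *-distribʳ-sum (v t) (λ s → ν s * κ s t)) ⟩
    ∑ (λ t → ∑ (λ s → ν s * κ s t * v t))      ≈⟨ ∑-comm (λ t s → ν s * κ s t * v t) ⟩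
    ∑ (λ s → ∑ (λ t → ν s * κ s t * v t))      ≈⟨ ∑-cong (λ s → ∑-cong λ t → *-assoc (ν s) (κ s t) (v t)) ⟩
    ∑ (λ s → ∑ (λ t → ν s * (κ s t * v t)))    ≈⟨ ∑-cong (λ s → *-distribˡ-sum (ν s) (λ t → κ s t * v t)) ⟨
    ν · (λ s → κ s · v)                        ∎
    where open ≈-Reasoning

  minimiser : ∀ {m p} {P : Pred (Fin m) p} → Decidable P → (f : Fin m → Carrier) →
              ∀ {i} → P i → ∃ λ j → P j × (∀ k → P k → f j ≤ f k)
  minimiser {m} P? f {i} Pi =
    argmin f i candidates ,
    argmin-all f Pi (all-filter P? (allFin m)) ,
    λ k Pk → lookup (f[argmin]≤f[xs] i candidates) (∈-filter⁺ P? (∈-allFin k) Pk)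
    where
    candidates : List (Fin m)
    candidates = filter P? (allFin m)

  -- The ratio test of the simplex method.
  min-ratio : ∀ {m} {α β : Fin m → Carrier} → (∀ j → 0# ≤ α j) → (∀ j → 0# ≤ β j) →
              (∀ j → Dec (α j ≈ 0#)) → ∀ {i} → ¬ α i ≈ 0# →
              ∃ λ b → ¬ α b ≈ 0# × ∃ λ t → 0# ≤ t × t * α b ≈ β b × (∀ j → t * α j ≤ β j)
  min-ratio {m} {α} {β} 0≤α 0≤β α? αi≉0 = select (minimiser (¬? ∘ α?) ratio αi≉0)
    where
    ratio : Fin m → Carrier
    ratio j = β j * reciprocal (α? j)

    ratio*α≈β : ∀ {j} → ¬ α j ≈ 0# → ratio j * α j ≈ β j
    ratio*α≈β {j} αj≉0 = begin
      β j * reciprocal (α? j) * α j    ≈⟨ *-assoc (β j) _ (α j) ⟩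
      β j * (reciprocal (α? j) * α j)  ≈⟨ *-congˡ (*-comm _ (α j)) ⟩
      β j * (α j * reciprocal (α? j))  ≈⟨ *-congˡ (reciprocal-inverse (α? j) αj≉0) ⟩
      β j * 1#                         ≈⟨ *-identityʳ (β j) ⟩
      β j                              ∎
      where open ≈-Reasoning

    select : (∃ λ b → ¬ α b ≈ 0# × (∀ k → ¬ α k ≈ 0# → ratio b ≤ ratio k)) →
             ∃ λ b → ¬ α b ≈ 0# × ∃ λ t → 0# ≤ t × t * α b ≈ β b × (∀ j → t * α j ≤ β j)
    select (b , αb≉0 , minimal) =
      b , αb≉0 , ratio b , *-nonneg (0≤β b) (reciprocal-nonneg (α? b) (0≤α b)) , ratio*α≈β αb≉0 , bounded
      where
      open ≤-Reasoning
      bounded : ∀ j → ratio b * α j ≤ β j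
      bounded j with α? j
      ... | yes αj≈0 = begin
        ratio b * α j  ≈⟨ *-congˡ αj≈0 ⟩
        ratio b * 0#   ≈⟨ zeroʳ (ratio b) ⟩
        0#             ≤⟨ 0≤β j ⟩
        β j            ∎
      ... | no αj≉0 = begin
        ratio b * α j  ≤⟨ *-monoʳ-≤ (α j) (0≤α j) (minimal j αj≉0) ⟩
        ratio j * α j  ≈⟨ ratio*α≈β αj≉0 ⟩
        β j            ∎

  -- Convex combinations

  sum≡∑ : ∀ {m} (f : Fin m → Carrier) → sum f ≡ ∑ f
  sum≡∑ {zero}  f = ≡.refl
  sum≡∑ {suc m} f = ≡.cong (f zero +_) (sum≡∑ (f ∘ suc))

  module _ {d : ℕ} (U : FinitePointSet d) where
    open FinitePointSet U

    infix 4 _∈φ_ _⊆φ⟨_⟩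

    _∈φ_ : Fin n → Subset n → Set
    i ∈φ Y = InConv U Y (pt i)

    _⊆φ⟨_⟩ : Subset n → Subset n → Set
    A ⊆φ⟨ B ⟩ = ∀ i → i ∈ A → i ∈φ B

    ConvexlyIndependent : Subset n → Set
    ConvexlyIndependent B = ∀ j → j ∈ B → ¬ j ∈φ (B ∖ j)

    -- In homogeneous coordinates (1, x) the two affine conditions ∑ c ≈ 1 and
    -- ∑ cⱼ pⱼ ≈ x of a convex combination become a single linear one.
    homogeneous : Point d → Point (suc d)
    homogeneous x zero    = 1#
    homogeneous x (suc k) = x k

    record Barycentric (c : Fin n → Carrier) (x : Point d) : Set where
      field
        nonneg  : ∀ j → 0# ≤ c j
        combine : ∀ k → c · (λ j → homogeneous (pt j) k) ≈ homogeneous x k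

      ∑≈1 : ∑ c ≈ 1#
      ∑≈1 = trans (∑-cong λ j → sym (*-identityʳ (c j))) (combine zero)

      ≤1 : ∀ j → c j ≤ 1#
      ≤1 j = ≤-trans (x≤∑ nonneg j) (≤-reflexive ∑≈1)
    open Barycentric

    SupportedOn : Subset n → (Fin n → Carrier) → Set
    SupportedOn Y c = ∀ j → j ∉ Y → c j ≈ 0#

    supported⇒∈ : ∀ {Y c j} → SupportedOn Y c → ¬ c j ≈ 0# → j ∈ Y
    supported⇒∈ {Y} {j = j} c-supp cj≉0 with j ∈? Y
    ... | yes j∈Y = j∈Y
    ... | no j∉Y  = ⊥-elim (cj≉0 (c-supp j j∉Y))

    fromInConv : ∀ {Y x} → InConv U Y x → ∃ λ c → Barycentric c x × SupportedOn Y c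
    fromInConv {x = x} (c , 0≤c , c-supp , sum-c≈1 , sum-cp≈x) =
      c , record { nonneg = 0≤c ; combine = c-combine } , c-supp
      where
      c-combine : ∀ k → c · (λ j → homogeneous (pt j) k) ≈ homogeneous x k
      c-combine zero    = trans (∑-cong λ j → *-identityʳ (c j)) (trans (reflexive (≡.sym (sum≡∑ c))) sum-c≈1)
      c-combine (suc k) = trans (reflexive (≡.sym (sum≡∑ λ j → c j * pt j k))) (sum-cp≈x k)

    toInConv : ∀ {Y c x} → Barycentric c x → SupportedOn Y c → InConv U Y x
    toInConv {c = c} c-bary c-supp =
      c , nonneg c-bary , c-supp , trans (reflexive (sum≡∑ c)) (∑≈1 c-bary) ,
      λ k → trans (reflexive (sum≡∑ λ j → c j * pt j k)) (combine c-bary (suc k))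

    InConv-mono : ∀ {Y Z x} → Y ⊆ Z → InConv U Y x → InConv U Z x
    InConv-mono Y⊆Z (c , 0≤c , c-supp , rest) = c , 0≤c , (λ j j∉Z → c-supp j (j∉Z ∘ Y⊆Z)) , rest

    barycentric-δ : ∀ i → Barycentric (δ i) (pt i)
    barycentric-δ i = record { nonneg = δ-nonneg i ; combine = λ k → δ-· i _ }

    δ-supported : ∀ {i Y} → i ∈ Y → SupportedOn Y (δ i)
    δ-supported {i} i∈Y j j∉Y with i ≟ j
    ... | yes ≡.refl = ⊥-elim (j∉Y i∈Y)
    ... | no i≢j     = reflexive (δ-off i≢j)

    ∈φ-refl : ∀ {i Y} → i ∈ Y → i ∈φ Y
    ∈φ-refl i∈Y = toInConv (barycentric-δ _) (δ-supported i∈Y)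

    barycentric-⊙ : ∀ {ν κ z} → Barycentric ν z → (∀ s → Barycentric (κ s) (pt s)) → Barycentric (ν ⊙ κ) z
    barycentric-⊙ {ν} {κ} {z} ν-bary κ-bary = record
      { nonneg  = λ t → ∑-nonneg λ s → *-nonneg (nonneg ν-bary s) (nonneg (κ-bary s) t)
      ; combine = λ k → begin
          (ν ⊙ κ) · (λ j → homogeneous (pt j) k)          ≈⟨ ·-⊙ ν κ _ ⟩
          ν · (λ s → κ s · (λ j → homogeneous (pt j) k))  ≈⟨ ·-congʳ ν (λ s → combine (κ-bary s) k) ⟩
          ν · (λ s → homogeneous (pt s) k)                ≈⟨ combine ν-bary k ⟩
          homogeneous z k                                 ∎
      }
      where open ≈-Reasoning

    supported-⊙ : ∀ {S T ν κ} → SupportedOn S ν → (∀ s → s ∈ S → SupportedOn T (κ s)) →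
                  SupportedOn T (ν ⊙ κ)
    supported-⊙ {S} {ν = ν} {κ} ν-supp κ-supp t t∉T = ∑-zero term≈0
      where
      term≈0 : ∀ s → ν s * κ s t ≈ 0#
      term≈0 s with s ∈? S
      ... | yes s∈S = trans (*-congˡ (κ-supp s s∈S t t∉T)) (zeroʳ (ν s))
      ... | no s∉S  = trans (*-congʳ (ν-supp s s∉S)) (zeroˡ (κ s t))

    choose-weights : ∀ {S T} → S ⊆φ⟨ T ⟩ →
      ∃ λ κ → (∀ s → Barycentric (κ s) (pt s)) × (∀ s → s ∈ S → SupportedOn T (κ s))
    choose-weights {S} {T} S⊆φT =
      (λ s → proj₁ (pick s)) , (λ s → proj₁ (proj₂ (pick s))) , (λ s → proj₂ (proj₂ (pick s)))
      where
      -- Outside S we take the trivial weights δ s, so that every κ s is barycentric.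
      pick : ∀ s → ∃ λ c → Barycentric c (pt s) × (s ∈ S → SupportedOn T c)
      pick s with s ∈? S
      ... | yes s∈S = let c , c-bary , c-supp = fromInConv (S⊆φT s s∈S) in c , c-bary , λ _ → c-supp
      ... | no s∉S  = δ s , barycentric-δ s , λ s∈S → ⊥-elim (s∉S s∈S)

    InConv-trans : ∀ {S T z} → InConv U S z → S ⊆φ⟨ T ⟩ → InConv U T z
    InConv-trans z∈φS S⊆φT with fromInConv z∈φS | choose-weights S⊆φT
    ... | ν , ν-bary , ν-supp | κ , κ-bary , κ-supp =
      toInConv (barycentric-⊙ ν-bary κ-bary) (supported-⊙ ν-supp κ-supp)

    ⊆φ-trans : ∀ {A B C} → A ⊆φ⟨ B ⟩ → B ⊆φ⟨ C ⟩ → A ⊆φ⟨ C ⟩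
    ⊆φ-trans A⊆φB B⊆φC i i∈A = InConv-trans (A⊆φB i i∈A) B⊆φC

    -- Exchange and extreme points

    unit-weight⇒≈ₚ : ∀ {c x b} → Barycentric c x → c b ≈ 1# → pt b ≈ₚ x
    unit-weight⇒≈ₚ {c} {x} {b} c-bary cb≈1 k = begin
      pt b k                ≈⟨ δ-· b (λ j → pt j k) ⟨
      δ b · (λ j → pt j k)  ≈⟨ ·-congˡ (λ j → pt j k) δ≈c ⟩
      c · (λ j → pt j k)    ≈⟨ combine c-bary (suc k) ⟩
      x k                   ∎
      where
      open ≈-Reasoning
      δ≤c : ∀ j → δ b j ≤ c j
      δ≤c j with b ≟ j
      ... | yes ≡.refl = ≤-reflexive (trans (reflexive (δ-diag b)) (sym cb≈1))
      ... | no b≢j     = ≤-trans (≤-reflexive (reflexive (δ-off b≢j))) (nonneg c-bary j)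
      δ≈c : ∀ j → δ b j ≈ c j
      δ≈c = ∑-tight δ≤c (trans (∑-δ b) (sym (∑≈1 c-bary)))

    -- Remove b from the combination b = ∑ wⱼ pⱼ and rescale by 1 / (1 - w b).
    ∈φ-without : ∀ {B w b} → Barycentric w (pt b) → SupportedOn B w → ¬ w b ≈ 1# → b ∈φ (B ∖ b)
    ∈φ-without {B} {w} {b} w-bary w-supp wb≉1 = toInConv c-bary c-supp
      where
      [1-wb]⁻¹ : ∃ λ r → (1# - w b) * r ≈ 1#
      [1-wb]⁻¹ = inverse (1# - w b) (wb≉1 ∘ sym ∘ x-y≈0⇒x≈y)
      r : Carrier
      r = proj₁ [1-wb]⁻¹

      w′ : Fin n → Carrier
      w′ j = w j + - w b * δ b j

      w′b≈0 : w′ b ≈ 0#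
      w′b≈0 = trans (+-congˡ (trans (*-congˡ (reflexive (δ-diag b))) (*-identityʳ (- w b)))) (-‿inverseʳ (w b))

      w′≈w : ∀ {j} → b ≢ j → w′ j ≈ w j
      w′≈w b≢j = trans (+-congˡ (trans (*-congˡ (reflexive (δ-off b≢j))) (zeroʳ (- w b)))) (+-identityʳ _)

      c : Fin n → Carrier
      c j = r * w′ j

      c-bary : Barycentric c (pt b)
      c-bary = record { nonneg = λ j → *-nonneg 0≤r (0≤w′ j) ; combine = c-combine }
        where
        0≤r : 0# ≤ r
        0≤r = inverse-nonneg (x≤y⇒0≤y-x (≤1 w-bary b)) (proj₂ [1-wb]⁻¹)
        0≤w′ : ∀ j → 0# ≤ w′ j
        0≤w′ j with b ≟ j
        ... | yes ≡.refl = ≤-reflexive (sym w′b≈0)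
        ... | no b≢j     = ≤-trans (nonneg w-bary j) (≤-reflexive (sym (w′≈w b≢j)))
        c-combine : ∀ k → c · (λ j → homogeneous (pt j) k) ≈ homogeneous (pt b) k
        c-combine k = begin
          c · v                          ≈⟨ ·-*ˡ r w′ v ⟩
          r * (w′ · v)                   ≈⟨ *-congˡ (·-+* w (- w b) (δ b) v) ⟩
          r * (w · v + - w b * (δ b · v)) ≈⟨ *-congˡ (+-cong (combine w-bary k) (*-congˡ (δ-· b v))) ⟩
          r * (v b + - w b * v b)        ≈⟨ r[x+-a*x]≈x (v b) (proj₂ [1-wb]⁻¹) ⟩
          v b                            ∎
          where
          open ≈-Reasoning
          v : Fin n → Carrier
          v j = homogeneous (pt j) k

      c-supp : SupportedOn (B ∖ b) c
      c-supp j j∉B∖b with b ≟ j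
      ... | yes ≡.refl = trans (*-congˡ w′b≈0) (zeroʳ r)
      ... | no b≢j     = trans (*-congˡ (trans (w′≈w b≢j) (w-supp j j∉B))) (zeroʳ r)
        where
        j∉B : j ∉ B
        j∉B j∈B = j∉B∖b (x∈p∧x≢y⇒x∈p-y j∈B (b≢j ∘ ≡.sym))

    -- Trade b for x: y = ∑ (β - t α)ⱼ pⱼ + t x, where β - t α vanishes at b.
    exchange-step : ∀ {B x y α β b t} → Barycentric α (pt x) → SupportedOn B α →
                    Barycentric β y → SupportedOn B β →
                    0# ≤ t → t * α b ≈ β b → (∀ j → t * α j ≤ β j) → InConv U ((B ∖ b) ∪ ⁅ x ⁆) y
    exchange-step {B} {x} {y} {α} {β} {b} {t} α-bary α-supp β-bary β-supp 0≤t tαb≈βb tα≤β =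
      toInConv c-bary c-supp
      where
      β′ : Fin n → Carrier
      β′ j = β j + - t * α j

      β′≈β-tα : ∀ j → β′ j ≈ β j - t * α j
      β′≈β-tα j = +-congˡ (sym (-‿distribˡ-* t (α j)))

      c : Fin n → Carrier
      c j = β′ j + t * δ x j

      c-bary : Barycentric c y
      c-bary = record { nonneg = c-nonneg ; combine = c-combine }
        where
        c-nonneg : ∀ j → 0# ≤ c j
        c-nonneg j = +-nonneg (≤-trans (x≤y⇒0≤y-x (tα≤β j)) (≤-reflexive (sym (β′≈β-tα j))))
                              (*-nonneg 0≤t (δ-nonneg x j))
        c-combine : ∀ k → c · (λ j → homogeneous (pt j) k) ≈ homogeneous y k
        c-combine k = begin
          c · v                                   ≈⟨ ·-+* β′ t (δ x) v ⟩
          β′ · v + t * (δ x · v)                  ≈⟨ +-cong (·-+* β (- t) α v) (*-congˡ (δ-· x v)) ⟩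
          (β · v + - t * (α · v)) + t * v x       ≈⟨ +-congʳ (+-cong (combine β-bary k) (*-congˡ (combine α-bary k))) ⟩
          (homogeneous y k + - t * v x) + t * v x ≈⟨ x+-a*y+a*y≈x _ t (v x) ⟩
          homogeneous y k                         ∎
          where
          open ≈-Reasoning
          v : Fin n → Carrier
          v j = homogeneous (pt j) k

      c-supp : SupportedOn ((B ∖ b) ∪ ⁅ x ⁆) c
      c-supp j j∉ = trans (+-cong β′j≈0 (trans (*-congˡ (reflexive (δ-off x≢j))) (zeroʳ t))) (+-identityʳ 0#)
        where
        x≢j : x ≢ j
        x≢j x≡j = j∉ (x∈p∪q⁺ (inj₂ (subst (_∈ ⁅ x ⁆) x≡j (x∈⁅x⁆ x))))
        β′j≈0 : β′ j ≈ 0#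
        β′j≈0 with b ≟ j
        ... | yes ≡.refl = trans (β′≈β-tα b) (trans (+-congˡ (-‿cong tαb≈βb)) (-‿inverseʳ (β b)))
        ... | no b≢j = begin
          β j + - t * α j  ≈⟨ +-cong (β-supp j j∉B) (*-congˡ (α-supp j j∉B)) ⟩
          0# + - t * 0#    ≈⟨ +-identityˡ _ ⟩
          - t * 0#         ≈⟨ zeroʳ (- t) ⟩
          0#               ∎
          where
          open ≈-Reasoning
          j∉B : j ∉ B
          j∉B j∈B = j∉ (x∈p∪q⁺ (inj₁ (x∈p∧x≢y⇒x∈p-y j∈B (b≢j ∘ ≡.sym))))

    exchange : ∀ {B x y} → x ∈φ B → InConv U B y →
               ¬ ¬ (∃ λ b → b ∈ B × InConv U ((B ∖ b) ∪ ⁅ x ⁆) y)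
    exchange {B} {x} {y} x∈φB y∈φB with fromInConv x∈φB | fromInConv y∈φB
    ... | α , α-bary , α-supp | β , β-bary , β-supp = ¬¬-map pivot (¬¬-∀ λ j → ¬¬-excluded-middle)
      where
      pivot : (∀ j → Dec (α j ≈ 0#)) → ∃ λ b → b ∈ B × InConv U ((B ∖ b) ∪ ⁅ x ⁆) y
      pivot α? with min-ratio (nonneg α-bary) (nonneg β-bary) α? (proj₂ (∃-nonzero α? (∑≈1 α-bary)))
      ... | b , αb≉0 , t , 0≤t , tαb≈βb , tα≤β =
        b , supported⇒∈ α-supp αb≉0 , exchange-step α-bary α-supp β-bary β-supp 0≤t tαb≈βb tα≤β

    -- Composing b ∈ φ(S ∖ b) with S ⊆ φ(B) gives weights w on B.  If w b ≉ 1 we can drop b;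
    -- w b ≈ 1 would force every s ∈ S ∖ b of nonzero weight to coincide with b.
    extreme-in-hull : ∀ {B S b} → ¬ b ∈φ (B ∖ b) → S ⊆φ⟨ B ⟩ → ¬ b ∈φ (S ∖ b)
    extreme-in-hull {S = S} {b} b∉φB∖b S⊆φB b∈φS∖b
      with fromInConv b∈φS∖b | choose-weights {S ∖ b} (λ s s∈S∖b → S⊆φB s (p─q⊆p S ⁅ b ⁆ s∈S∖b))
    ... | ν , ν-bary , ν-supp | κ , κ-bary , κ-supp =
      b∉φB∖b (∈φ-without (barycentric-⊙ ν-bary κ-bary) (supported-⊙ ν-supp κ-supp) w≉1)
      where
      w≉1 : ¬ (ν ⊙ κ) b ≈ 1#
      w≉1 w≈1 = 0≉1 (trans (sym (∑-zero ν≈0)) (∑≈1 ν-bary))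
        where
        νκ≤ν : ∀ s → ν s * κ s b ≤ ν s
        νκ≤ν s = ≤-trans (*-monoˡ-≤ (ν s) (nonneg ν-bary s) (≤1 (κ-bary s) b)) (≤-reflexive (*-identityʳ (ν s)))
        νκ≈ν : ∀ s → ν s * κ s b ≈ ν s
        νκ≈ν = ∑-tight νκ≤ν (trans w≈1 (sym (∑≈1 ν-bary)))
        ν≈0 : ∀ s → ν s ≈ 0#
        ν≈0 s with s ≟ b
        ... | yes ≡.refl = ν-supp s (x∉p∖x S)
        ... | no s≢b     = x*y≈x⇒x≈0 κsb≉1 (νκ≈ν s)
          where
          κsb≉1 : ¬ κ s b ≈ 1#
          κsb≉1 κsb≈1 = s≢b (pt-inj s b λ k → sym (unit-weight⇒≈ₚ (κ-bary s) κsb≈1 k))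

    redundant⇒⊆φ⟨∖⟩ : ∀ {A j} → j ∈φ (A ∖ j) → A ⊆φ⟨ A ∖ j ⟩
    redundant⇒⊆φ⟨∖⟩ {A} {j} j∈φA∖j i i∈A with i ≟ j
    ... | yes ≡.refl = j∈φA∖j
    ... | no i≢j     = ∈φ-refl (x∈p∧x≢y⇒x∈p-y i∈A i≢j)

    -- A is independent unless some j ∈ A lies in φ(A ∖ j), in which case we recurse on A ∖ j;
    -- the double negation spares us from deciding which case holds.
    independent-spanning-subset : ∀ A → ¬ ¬ (∃ λ B → B ⊆ A × A ⊆φ⟨ B ⟩ × ConvexlyIndependent B)
    independent-spanning-subset A = go A (⊂-wellFounded A)
      where
      go : ∀ A → Acc _⊂_ A → ¬ ¬ (∃ λ B → B ⊆ A × A ⊆φ⟨ B ⟩ × ConvexlyIndependent B)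
      go A (acc rec) k = k (A , (λ i∈A → i∈A) , (λ i → ∈φ-refl) , independent)
        where
        independent : ConvexlyIndependent A
        independent j j∈A j∈φA∖j = go (A ∖ j) (rec (x∈p⇒p-x⊂p j∈A)) λ (B , B⊆A∖j , A∖j⊆φB , B-indep) →
          k (B , (λ i∈B → p─q⊆p A ⁅ j ⁆ (B⊆A∖j i∈B)) , ⊆φ-trans (redundant⇒⊆φ⟨∖⟩ j∈φA∖j) A∖j⊆φB , B-indep)

    -- Quasi-closed sets

    ¬closed⇒outside : ∀ {Q} → ¬ Closed U Q → ¬ ¬ (∃ λ y → y ∈φ Q × y ∉ Q)
    ¬closed⇒outside {Q} ¬closed k = ¬closed closed
      where
      closed : Closed U Q
      closed i i∈φQ with i ∈? Q
      ... | yes i∈Q = i∈Q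
      ... | no i∉Q  = ⊥-elim (k (i , i∈φQ , i∉Q))

    -- For x ∈ Q ∖ B, exchanging x against some b ∈ B puts y into φ(Q ∖ b) ⊊ φ(Q),
    -- hence into Q by quasi-closedness.
    quasiClosed⇒⊆basis : ∀ {Q B y} → QuasiClosed U Q → B ⊆ Q → Q ⊆φ⟨ B ⟩ → ConvexlyIndependent B →
                          y ∈φ Q → y ∉ Q → Q ⊆ B
    quasiClosed⇒⊆basis {Q} {B} {y} (_ , qc) B⊆Q Q⊆φB B-indep y∈φQ y∉Q {x} x∈Q with x ∈? B
    ... | yes x∈B = x∈B
    ... | no x∉B  = ⊥-elim (exchange (Q⊆φB x x∈Q) (InConv-trans y∈φQ Q⊆φB) λ (b , b∈B , y∈φ) →
                      y∉Q (qc (Q ∖ b) (p─q⊆p Q ⁅ b ⁆) (strict b∈B) y (InConv-mono (⊆Q∖b b∈B) y∈φ)))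
      where
      strict : ∀ {b} → b ∈ B → _⊊φ_ U (Q ∖ b) Q
      strict {b} b∈B =
        (λ i → InConv-mono (p─q⊆p Q ⁅ b ⁆)) ,
        λ Q⊆φQ∖b → extreme-in-hull (B-indep b b∈B) Q⊆φB (Q⊆φQ∖b b (∈φ-refl (B⊆Q b∈B)))
      ⊆Q∖b : ∀ {b} → b ∈ B → (B ∖ b) ∪ ⁅ x ⁆ ⊆ Q ∖ b
      ⊆Q∖b {b} b∈B {i} i∈ with x∈p∪q⁻ (B ∖ b) ⁅ x ⁆ i∈
      ... | inj₁ i∈B∖b = x∈p∧x≢y⇒x∈p-y (B⊆Q (p─q⊆p B ⁅ b ⁆ i∈B∖b)) (x∈p∖y⇒x≢y B i∈B∖b)
      ... | inj₂ i∈⁅x⁆ rewrite x∈⁅y⁆⇒x≡y x i∈⁅x⁆ =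
        x∈p∧x≢y⇒x∈p-y x∈Q λ x≡b → x∉B (subst (_∈ B) (≡.sym x≡b) b∈B)

    quasiClosed⇒independent : ∀ {Q} → QuasiClosed U Q → ConvexlyIndependent Q
    quasiClosed⇒independent {Q} qcQ@(¬closed , _) j j∈Q j∈φQ∖j =
      independent-spanning-subset Q λ (B , B⊆Q , Q⊆φB , B-indep) →
      ¬closed⇒outside ¬closed λ (y , y∈φQ , y∉Q) →
      let Q≡B = ⊆-antisym (quasiClosed⇒⊆basis qcQ B⊆Q Q⊆φB B-indep y∈φQ y∉Q) B⊆Q
      in subst ConvexlyIndependent (≡.sym Q≡B) B-indep j j∈Q j∈φQ∖j

    quasiClosedOf⊆ex : ∀ {C Q E} → QuasiClosedOf U C Q → IsEx U C E → Q ⊆ E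
    quasiClosedOf⊆ex (qcQ , φQ≐C) ex {x} x∈Q = proj₂ (ex x)
      ( proj₁ (φQ≐C x) (∈φ-refl x∈Q)
      , extreme-in-hull (quasiClosed⇒independent qcQ x x∈Q) (λ i → proj₂ (φQ≐C i)) )

    ex⊆quasiClosedOf : ∀ {C Q E} → φ_≐_ U Q C → IsEx U C E → E ⊆ Q
    ex⊆quasiClosedOf {C} {Q} φQ≐C ex {i} i∈E with i ∈? Q | proj₁ (ex i) i∈E
    ... | yes i∈Q | _            = i∈Q
    ... | no i∉Q  | i∈C , i∉φC∖i = ⊥-elim (i∉φC∖i (InConv-mono Q⊆C∖i (proj₂ (φQ≐C i) i∈C)))
      where
      Q⊆C∖i : Q ⊆ C ∖ i
      Q⊆C∖i {j} j∈Q = x∈p∧x≢y⇒x∈p-y (proj₁ (φQ≐C j) (∈φ-refl j∈Q)) λ j≡i → i∉Q (subst (_∈ Q) j≡i j∈Q)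

lemma6 : (K : OrderedField) → (d : ℕ) → (U : ConvexGeometry.FinitePointSet K d) →
    (C E : Subset (ConvexGeometry.FinitePointSet.n U)) →
    ConvexGeometry.Essential K U C →
    ConvexGeometry.IsEx K U C E →
    ConvexGeometry.QuasiClosedOf K U C E ×
      (∀ Q → ConvexGeometry.QuasiClosedOf K U C Q → Q ⊆ E)
lemma6 K d U C E (Q , QC) ex =
  subst (ConvexGeometry.QuasiClosedOf K U C) Q≡E QC , λ Q′ QC′ → quasiClosedOf⊆ex K U QC′ ex
  where
  Q≡E : Q ≡ E
  Q≡E = ⊆-antisym (quasiClosedOf⊆ex K U QC ex) (ex⊆quasiClosedOf K U (proj₂ QC) ex)
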